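{- Let $G$ be a graph on $n$ vertices such that both $G$ and its complement $\bar G$ are connected. Then \[\gamma_{1/2}(G)+\gamma_{1/2}(\bar G)\leq \left\lceil \frac{1}{2}\left\lfloor \frac{n}{2}\right\rfloor\right\rceil+2.\]
   Context: All graphs are finite and simple; $\bar G$ is the complement of $G$. For a graph $G=(V,E)$ and $v\in V$, $N[v]=\{v\}\cup\{u : uv\in E\}$, and for $S\subseteq V$, $N[S]=\bigcup_{u\in S}N[u]$. For $p\in[0,1]$, a set $S\subseteq V$ is a $p$-dominating set if $|N[S]|/|V|\geq p$; $\gamma_p(G)$ is the minimum cardinality of a $p$-dominating set of $G$. -}

module Defs where

open import Data.Nat using (ℕ; zero; suc; _+_; _*_; _≤_; ⌊_/2⌋; ⌈_/2⌉)
open import Data.Fin using (Fin; _≟_)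
open import Data.Fin.Properties using (any?)
open import Data.Bool using (Bool; true; false; not; _∧_)
open import Data.Fin.Subset using (Subset; ∣_∣; _∈_)
open import Data.Vec using (tabulate)
open import Data.List using (List; []; _∷_)
open import Relation.Nullary using (yes; no)
open import Relation.Nullary.Decidable using (⌊_⌋)
open import Data.Product using (Σ; _×_; ∃)
open import Relation.Binary.PropositionalEquality using (_≡_; refl; sym; cong; cong₂)

record Graph (n : ℕ) : Set where
  field
    adj    : Fin n → Fin n → Bool
    adj-sym    : ∀ u v → adj u v ≡ adj v u
    adj-irrefl : ∀ v → adj v v ≡ false
open Graph public

neq : ∀ {n} → Fin n → Fin n → Bool
neq u v = not ⌊ u ≟ v ⌋

neq-sym : ∀ {n} (u v : Fin n) → neq u v ≡ neq v u
neq-sym u v with u ≟ v | v ≟ u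
... | yes _ | yes _ = refl
... | no _  | no _  = refl
... | yes p | no q  = Data.Empty.⊥-elim (q (sym p))
  where import Data.Empty
... | no p  | yes q = Data.Empty.⊥-elim (p (sym q))
  where import Data.Empty

neq-refl : ∀ {n} (v : Fin n) → neq v v ≡ false
neq-refl v with v ≟ v
... | yes _ = refl
... | no p  = Data.Empty.⊥-elim (p refl)
  where import Data.Empty

complement : ∀ {n} → Graph n → Graph n
complement G = record
  { adj = λ u v → not (adj G u v) ∧ neq u v
  ; adj-sym = λ u v → cong₂ (λ a b → not a ∧ b) (adj-sym G u v) (neq-sym u v)
  ; adj-irrefl = λ v → helper (not (adj G v v)) (neq-refl v)
  }
  where
  helper : ∀ (a : Bool) {b} → b ≡ false → a ∧ b ≡ false
  helper false _ = refl
  helper true  p = p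

data Walk {n} (G : Graph n) : Fin n → Fin n → Set where
  here : ∀ {u} → Walk G u u
  step : ∀ {u w v} → adj G u w ≡ true → Walk G w v → Walk G u v

Connected : ∀ {n} → Graph n → Set
Connected {n} G = ∀ (u v : Fin n) → Walk G u v

closedNbhd : ∀ {n} → Graph n → Subset n → Subset n
closedNbhd G S =
  tabulate λ v → ⌊ any? (λ u → Data.Bool._≟_ (Data.Vec.lookup S u ∧ (⌊ u ≟ v ⌋ Data.Bool.∨ adj G u v)) true) ⌋
  where import Data.Bool

-- S is a 1/2-dominating set: |N[S]| / n ≥ 1/2, i.e. 2·|N[S]| ≥ n.
IsHalfDominating : ∀ {n} → Graph n → Subset n → Set
IsHalfDominating {n} G S = n ≤ 2 * ∣ closedNbhd G S ∣

IsGammaHalf : ∀ {n} → Graph n → ℕ → Set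
IsGammaHalf {n} G k =
  (Σ (Subset n) λ S → IsHalfDominating G S × ∣ S ∣ ≡ k)
  × (∀ (S : Subset n) → IsHalfDominating G S → k ≤ ∣ S ∣)

-- By Ore's theorem a graph without isolated vertices has a dominating set of
-- size at most ⌊n/2⌋: the complement of a minimal dominating set is again
-- dominating.  Splitting such a set into two halves, the closed neighbourhoods
-- of the halves cover all n vertices, so one of them covers at least n/2, and
-- γ_{1/2} ≤ ⌈⌊n/2⌋/2⌉ whenever G is connected and n ≥ 2.  On the other hand
-- every vertex v satisfies N_G[v] ∪ N_Ḡ[v] = V, so v alone is a
-- 1/2-dominating set of G or of Ḡ.
module Submission where

open import Defs
open import Data.Bool using (true; false; _∧_; _∨_) renaming (_≟_ to _≟ᵇ_)
open import Data.Bool.Properties using (∨-zeroʳ)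
open import Data.Empty using (⊥-elim)
open import Data.Fin using (Fin; _≟_) renaming (zero to fzero; suc to fsuc)
open import Data.Fin.Properties using (any?; all?)
open import Data.Fin.Subset using (Subset; ∣_∣; _∈_; _-_; _∪_; ∁; ⊤; ⁅_⁆; inside; outside)
open import Data.Fin.Subset.Properties
  using (_∈?_; ∪-comm; x∈p∪q⁺; x∈p∪q⁻; p⊆q⇒∣p∣≤∣q∣; ∣p∣≤n; ∣⊤∣≡n; ∣∁p∣≡n∸∣p∣; ∣⁅x⁆∣≡1;
         ∈⊤; x∈⁅x⁆; x∉p⇒x∈∁p; x∈p∧x≢y⇒x∈p-y; x∈p⇒∣p-x∣<∣p∣)
open import Data.Nat using (ℕ; zero; suc; _+_; _*_; _≤_; z≤n; s≤s; ⌊_/2⌋; ⌈_/2⌉)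
open import Data.Nat.Properties
  using (≤-trans; ≤-reflexive; ≤-total; ≤-pred; n≤1+n; n≮0; +-suc; +-comm; +-identityʳ;
         +-mono-≤; +-monoˡ-≤; +-monoʳ-≤; m+[n∸m]≡n; n≡⌊n+n/2⌋; ⌊n/2⌋-mono; ⌈n/2⌉-mono; ⌊n/2⌋≤⌈n/2⌉)
open import Data.Product using (Σ; ∃; _×_; _,_; proj₁; proj₂)
open import Data.Sum using (_⊎_; inj₁; inj₂; [_,_]′) renaming (map to ⊎-map)
open import Data.Vec using ([]; _∷_; lookup)
open import Data.Vec.Properties using (lookup∘tabulate; []=⇒lookup; lookup⇒[]=)
open import Function using (id; _∘_)
open import Relation.Nullary using (¬_; Dec; yes; no; ¬?)
open import Relation.Nullary.Decidable using (⌊_⌋; _×-dec_; decidable-stable)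
open import Relation.Binary.PropositionalEquality using (_≡_; _≢_; ≢-sym; refl; sym; trans; cong; subst)

∣p∪q∣≤∣p∣+∣q∣ : ∀ {n} (p q : Subset n) → ∣ p ∪ q ∣ ≤ ∣ p ∣ + ∣ q ∣
∣p∪q∣≤∣p∣+∣q∣ []            []            = z≤n
∣p∪q∣≤∣p∣+∣q∣ (inside  ∷ p) (inside  ∷ q) =
  s≤s (≤-trans (∣p∪q∣≤∣p∣+∣q∣ p q) (+-monoʳ-≤ ∣ p ∣ (n≤1+n ∣ q ∣)))
∣p∪q∣≤∣p∣+∣q∣ (inside  ∷ p) (outside ∷ q) = s≤s (∣p∪q∣≤∣p∣+∣q∣ p q)
∣p∪q∣≤∣p∣+∣q∣ (outside ∷ p) (inside  ∷ q) =
  subst (suc ∣ p ∪ q ∣ ≤_) (sym (+-suc ∣ p ∣ ∣ q ∣)) (s≤s (∣p∪q∣≤∣p∣+∣q∣ p q))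
∣p∪q∣≤∣p∣+∣q∣ (outside ∷ p) (outside ∷ q) = ∣p∪q∣≤∣p∣+∣q∣ p q

∣p∣+∣∁p∣≡n : ∀ {n} (p : Subset n) → ∣ p ∣ + ∣ ∁ p ∣ ≡ n
∣p∣+∣∁p∣≡n p = trans (cong (∣ p ∣ +_) (∣∁p∣≡n∸∣p∣ p)) (m+[n∸m]≡n (∣p∣≤n p))

covering⇒n≤∣p∣+∣q∣ : ∀ {n} {p q : Subset n} → (∀ x → x ∈ p ⊎ x ∈ q) → n ≤ ∣ p ∣ + ∣ q ∣
covering⇒n≤∣p∣+∣q∣ {n} {p} {q} covering = ≤-trans (≤-reflexive (sym (∣⊤∣≡n n)))
  (≤-trans (p⊆q⇒∣p∣≤∣q∣ {p = ⊤} (λ {x} _ → x∈p∪q⁺ (covering x))) (∣p∪q∣≤∣p∣+∣q∣ p q))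

m≤n+o⇒m≤2*n⊎m≤2*o : ∀ {m} n o → m ≤ n + o → m ≤ 2 * n ⊎ m ≤ 2 * o
m≤n+o⇒m≤2*n⊎m≤2*o n o m≤n+o with ≤-total n o
... | inj₁ n≤o = inj₂ (≤-trans m≤n+o (subst (n + o ≤_) (cong (o +_) (sym (+-identityʳ o))) (+-monoˡ-≤ o n≤o)))
... | inj₂ o≤n = inj₁ (≤-trans m≤n+o (subst (n + o ≤_) (cong (n +_) (sym (+-identityʳ n))) (+-monoʳ-≤ n o≤n)))

m+n≡o⇒m≤⌊o/2⌋⊎n≤⌊o/2⌋ : ∀ {m n o} → m + n ≡ o → m ≤ ⌊ o /2⌋ ⊎ n ≤ ⌊ o /2⌋
m+n≡o⇒m≤⌊o/2⌋⊎n≤⌊o/2⌋ {m} {n} refl with ≤-total m n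
... | inj₁ m≤n = inj₁ (subst (_≤ ⌊ m + n /2⌋) (sym (n≡⌊n+n/2⌋ m)) (⌊n/2⌋-mono (+-monoʳ-≤ m m≤n)))
... | inj₂ n≤m = inj₂ (subst (_≤ ⌊ m + n /2⌋) (sym (n≡⌊n+n/2⌋ n)) (⌊n/2⌋-mono (+-monoˡ-≤ n n≤m)))

halves : ∀ {n} → Subset n → Subset n × Subset n
halves []            = [] , []
halves (outside ∷ p) = outside ∷ proj₁ (halves p) , outside ∷ proj₂ (halves p)
halves (inside  ∷ p) = inside  ∷ proj₂ (halves p) , outside ∷ proj₁ (halves p)

halves-∪ : ∀ {n} (p : Subset n) → proj₁ (halves p) ∪ proj₂ (halves p) ≡ p
halves-∪ []            = refl
halves-∪ (outside ∷ p) = cong (outside ∷_) (halves-∪ p)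
halves-∪ (inside  ∷ p) = cong (inside ∷_) (trans (∪-comm (proj₂ (halves p)) _) (halves-∪ p))

halves-size : ∀ {n} (p : Subset n) →
  ∣ proj₁ (halves p) ∣ ≡ ⌈ ∣ p ∣ /2⌉ × ∣ proj₂ (halves p) ∣ ≡ ⌊ ∣ p ∣ /2⌋
halves-size []            = refl , refl
halves-size (outside ∷ p) = halves-size p
halves-size (inside  ∷ p) with halves-size p
... | size₁ , size₂ = cong suc size₂ , size₁

halfDominating-⊎ : ∀ {n} (G H : Graph n) {A B : Subset n} →
  (∀ w → w ∈ closedNbhd G A ⊎ w ∈ closedNbhd H B) → IsHalfDominating G A ⊎ IsHalfDominating H B
halfDominating-⊎ G H {A} {B} covering =
  m≤n+o⇒m≤2*n⊎m≤2*o ∣ closedNbhd G A ∣ ∣ closedNbhd H B ∣ (covering⇒n≤∣p∣+∣q∣ covering)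

isYes≡true⇒ : ∀ {A : Set} (a? : Dec A) → ⌊ a? ⌋ ≡ true → A
isYes≡true⇒ (yes a) _ = a

⇒isYes≡true : ∀ {A : Set} (a? : Dec A) → A → ⌊ a? ⌋ ≡ true
⇒isYes≡true (yes _) _ = refl
⇒isYes≡true (no ¬a) a = ⊥-elim (¬a a)

module _ {n : ℕ} (G : Graph n) where

  adj⇒≢ : ∀ {u v} → adj G u v ≡ true → u ≢ v
  adj⇒≢ {u} u~u refl with trans (sym u~u) (adj-irrefl G u)
  ... | ()

  ∈-closedNbhd⁺ : ∀ {S u w} → u ∈ S → u ≡ w ⊎ adj G u w ≡ true → w ∈ closedNbhd G S
  ∈-closedNbhd⁺ {S} {u} {w} u∈S u~w =
    lookup⇒[]= w (closedNbhd G S) (trans (lookup∘tabulate _ w) (⇒isYes≡true (any? _) (u , u∈S∧u~w)))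
    where
    covers : u ≡ w ⊎ adj G u w ≡ true → ⌊ u ≟ w ⌋ ∨ adj G u w ≡ true
    covers (inj₁ u≡w) rewrite ⇒isYes≡true (u ≟ w) u≡w = refl
    covers (inj₂ u~w) rewrite u~w = ∨-zeroʳ _
    u∈S∧u~w : lookup S u ∧ (⌊ u ≟ w ⌋ ∨ adj G u w) ≡ true
    u∈S∧u~w rewrite []=⇒lookup u∈S = covers u~w

  ∈-closedNbhd⁻ : ∀ {S w} → w ∈ closedNbhd G S → ∃ λ u → u ∈ S × (u ≡ w ⊎ adj G u w ≡ true)
  ∈-closedNbhd⁻ {S} {w} w∈N[S]
    with isYes≡true⇒ (any? _) (trans (sym (lookup∘tabulate _ w)) ([]=⇒lookup w∈N[S]))
  ... | u , u∈S∧u~w with lookup S u in u∈S | u ≟ w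
  -- lookup S u ≡ false would make u∈S∧u~w a proof of false ≡ true
  ...   | true | yes u≡w = u , lookup⇒[]= u S u∈S , inj₁ u≡w
  ...   | true | no _    = u , lookup⇒[]= u S u∈S , inj₂ u∈S∧u~w

  ∈-closedNbhd-∪⁻ : ∀ {A B w} → w ∈ closedNbhd G (A ∪ B) → w ∈ closedNbhd G A ⊎ w ∈ closedNbhd G B
  ∈-closedNbhd-∪⁻ {A} {B} w∈N[A∪B] with ∈-closedNbhd⁻ w∈N[A∪B]
  ... | u , u∈A∪B , u~w =
    ⊎-map (λ u∈A → ∈-closedNbhd⁺ u∈A u~w) (λ u∈B → ∈-closedNbhd⁺ u∈B u~w) (x∈p∪q⁻ A B u∈A∪B)

  Dominates : Subset n → Set
  Dominates S = ∀ w → w ∈ closedNbhd G S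

  dominates? : ∀ S → Dec (Dominates S)
  dominates? S = all? (λ w → w ∈? closedNbhd G S)

  ⊤-dominates : Dominates ⊤
  ⊤-dominates w = ∈-closedNbhd⁺ ∈⊤ (inj₁ refl)

  MinimalDominating : Subset n → Set
  MinimalDominating D = Dominates D × (∀ {v} → v ∈ D → ¬ Dominates (D - v))

  minimalDominating : Σ (Subset n) MinimalDominating
  minimalDominating = shrink n ⊤ (≤-reflexive (∣⊤∣≡n n)) ⊤-dominates
    where
    shrink : ∀ fuel X → ∣ X ∣ ≤ fuel → Dominates X → Σ (Subset n) MinimalDominating
    shrink fuel X ∣X∣≤fuel domX with any? (λ v → (v ∈? X) ×-dec dominates? (X - v))
    shrink fuel X ∣X∣≤fuel domX | no irremovable =
      X , domX , λ v∈X domX-v → irremovable (_ , v∈X , domX-v)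
    shrink zero X ∣X∣≤0 domX | yes (v , v∈X , _) =
      ⊥-elim (n≮0 (≤-trans (x∈p⇒∣p-x∣<∣p∣ v∈X) ∣X∣≤0))
    shrink (suc fuel) X ∣X∣≤1+fuel domX | yes (v , v∈X , domX-v) =
      shrink fuel (X - v) (≤-pred (≤-trans (x∈p⇒∣p-x∣<∣p∣ v∈X) ∣X∣≤1+fuel)) domX-v

  NoIsolatedVertex : Set
  NoIsolatedVertex = ∀ v → ∃ λ u → adj G v u ≡ true

  dominates-minus : NoIsolatedVertex → ∀ {D} w → Dominates D →
    (∀ {y} → adj G w y ≡ true → y ∈ D) → Dominates (D - w)
  dominates-minus noIsolated {D} w domD nbrs⊆D z with ∈-closedNbhd⁻ (domD z)
  ... | u , u∈D , u~z with u ≟ w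
  ...   | no u≢w = ∈-closedNbhd⁺ {S = D - w} (x∈p∧x≢y⇒x∈p-y u∈D u≢w) u~z
  ...   | yes refl with u~z
  ...     | inj₂ w~z =
    ∈-closedNbhd⁺ {S = D - w} (x∈p∧x≢y⇒x∈p-y (nbrs⊆D w~z) (≢-sym (adj⇒≢ w~z))) (inj₁ refl)
  ...     | inj₁ refl with noIsolated w
  ...       | y , w~y =
    ∈-closedNbhd⁺ {S = D - w} (x∈p∧x≢y⇒x∈p-y (nbrs⊆D w~y) (≢-sym (adj⇒≢ w~y))) (inj₂ (trans (adj-sym G y w) w~y))

  ∁-dominates : NoIsolatedVertex → ∀ {D} → MinimalDominating D → Dominates (∁ D)
  ∁-dominates noIsolated {D} (domD , minimal) w with w ∈? D
  ... | no w∉D = ∈-closedNbhd⁺ (x∉p⇒x∈∁p w∉D) (inj₁ refl)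
  ... | yes w∈D with any? (λ y → (adj G w y ≟ᵇ true) ×-dec ¬? (y ∈? D))
  ...   | yes (y , w~y , y∉D) = ∈-closedNbhd⁺ (x∉p⇒x∈∁p y∉D) (inj₂ (trans (adj-sym G y w) w~y))
  ...   | no noOutsideNbr = ⊥-elim (minimal w∈D (dominates-minus noIsolated {D} w domD nbrs⊆D))
    where
    nbrs⊆D : ∀ {y} → adj G w y ≡ true → y ∈ D
    nbrs⊆D {y} w~y = decidable-stable (y ∈? D) (λ y∉D → noOutsideNbr (y , w~y , y∉D))

  dominatingSet-≤⌊n/2⌋ : NoIsolatedVertex → ∃ λ X → Dominates X × ∣ X ∣ ≤ ⌊ n /2⌋
  dominatingSet-≤⌊n/2⌋ noIsolated with minimalDominating
  ... | D , minD with m+n≡o⇒m≤⌊o/2⌋⊎n≤⌊o/2⌋ (∣p∣+∣∁p∣≡n D)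
  ...   | inj₁ ∣D∣≤ = D , proj₁ minD , ∣D∣≤
  ...   | inj₂ ∣∁D∣≤ = ∁ D , ∁-dominates noIsolated minD , ∣∁D∣≤

  dominating⇒halfDominating : ∀ {S} → Dominates S → IsHalfDominating G S
  dominating⇒halfDominating {S} domS = [ id , id ]′ (halfDominating-⊎ G G {S} {S} (inj₁ ∘ domS))

  halfDominatingSet-≤⌈∣X∣/2⌉ : ∀ {X} → Dominates X →
    ∃ λ S → IsHalfDominating G S × ∣ S ∣ ≤ ⌈ ∣ X ∣ /2⌉
  halfDominatingSet-≤⌈∣X∣/2⌉ {X} domX
    with halfDominating-⊎ G G {proj₁ (halves X)} {proj₂ (halves X)} covering | halves-size X
    where
    covering : ∀ w → w ∈ closedNbhd G (proj₁ (halves X)) ⊎ w ∈ closedNbhd G (proj₂ (halves X))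
    covering w = ∈-closedNbhd-∪⁻ {proj₁ (halves X)} {proj₂ (halves X)}
      (subst (λ S → w ∈ closedNbhd G S) (sym (halves-∪ X)) (domX w))
  ... | inj₁ half₁ | size₁ , _ = proj₁ (halves X) , half₁ , ≤-reflexive size₁
  ... | inj₂ half₂ | _ , size₂ = proj₂ (halves X) , half₂ , ≤-trans (≤-reflexive size₂) (⌊n/2⌋≤⌈n/2⌉ ∣ X ∣)

  γ½≤⌈⌊n/2⌋/2⌉ : NoIsolatedVertex → ∀ {k} → IsGammaHalf G k → k ≤ ⌈ ⌊ n /2⌋ /2⌉
  γ½≤⌈⌊n/2⌋/2⌉ noIsolated (_ , minimum) with dominatingSet-≤⌊n/2⌋ noIsolated
  ... | X , domX , ∣X∣≤ with halfDominatingSet-≤⌈∣X∣/2⌉ {X} domX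
  ...   | S , halfS , ∣S∣≤ = ≤-trans (minimum S halfS) (≤-trans ∣S∣≤ (⌈n/2⌉-mono ∣X∣≤))

  γ½≤n : ∀ {k} → IsGammaHalf G k → k ≤ n
  γ½≤n {k} (_ , minimum) = subst (k ≤_) (∣⊤∣≡n n) (minimum ⊤ (dominating⇒halfDominating {⊤} ⊤-dominates))

  γ½≤1 : ∀ {k v} → IsGammaHalf G k → IsHalfDominating G ⁅ v ⁆ → k ≤ 1
  γ½≤1 {k} {v} (_ , minimum) half = subst (k ≤_) (∣⁅x⁆∣≡1 v) (minimum ⁅ v ⁆ half)

complement-adj : ∀ {n} (G : Graph n) {u v} → adj G u v ≡ false → u ≢ v → adj (complement G) u v ≡ true
complement-adj G {u} {v} u≁v u≢v with u ≟ v
... | yes u≡v = ⊥-elim (u≢v u≡v)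
... | no _ rewrite u≁v = refl

vertex-halfDominates-or-complement : ∀ {n} (G : Graph n) v →
  IsHalfDominating G ⁅ v ⁆ ⊎ IsHalfDominating (complement G) ⁅ v ⁆
vertex-halfDominates-or-complement G v = halfDominating-⊎ G (complement G) {⁅ v ⁆} {⁅ v ⁆} covering
  where
  covering : ∀ w → w ∈ closedNbhd G ⁅ v ⁆ ⊎ w ∈ closedNbhd (complement G) ⁅ v ⁆
  covering w with v ≟ w | adj G v w in v~w?
  ... | yes v≡w | _     = inj₁ (∈-closedNbhd⁺ G (x∈⁅x⁆ v) (inj₁ v≡w))
  ... | no _    | true  = inj₁ (∈-closedNbhd⁺ G (x∈⁅x⁆ v) (inj₂ v~w?))
  ... | no v≢w  | false = inj₂ (∈-closedNbhd⁺ (complement G) (x∈⁅x⁆ v) (inj₂ (complement-adj G v~w? v≢w)))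

connected⇒noIsolatedVertex : ∀ {m} (G : Graph (suc (suc m))) → Connected G → NoIsolatedVertex G
connected⇒noIsolatedVertex {m} G connected v = firstStep (connected v (other v)) (≢-other v)
  where
  other : Fin (suc (suc m)) → Fin (suc (suc m))
  other fzero    = fsuc fzero
  other (fsuc _) = fzero
  ≢-other : ∀ x → x ≢ other x
  ≢-other fzero    ()
  ≢-other (fsuc _) ()
  firstStep : ∀ {u w} → Walk G u w → u ≢ w → ∃ λ x → adj G u x ≡ true
  firstStep here       u≢u = ⊥-elim (u≢u refl)
  firstStep (step u~x _) _ = _ , u~x

γ½+γ½≤⌈⌊n/2⌋/2⌉+1 : ∀ {m} (G : Graph (suc (suc m))) → Connected G → Connected (complement G) →
  ∀ {k k'} → IsGammaHalf G k → IsGammaHalf (complement G) k' → k + k' ≤ ⌈ ⌊ suc (suc m) /2⌋ /2⌉ + 1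
γ½+γ½≤⌈⌊n/2⌋/2⌉+1 G connected connected' γk γk' with vertex-halfDominates-or-complement G fzero
... | inj₁ half = ≤-trans
        (+-mono-≤ (γ½≤1 G {v = fzero} γk half)
                  (γ½≤⌈⌊n/2⌋/2⌉ (complement G) (connected⇒noIsolatedVertex (complement G) connected') γk'))
        (≤-reflexive (+-comm 1 _))
... | inj₂ half =
        +-mono-≤ (γ½≤⌈⌊n/2⌋/2⌉ G (connected⇒noIsolatedVertex G connected) γk)
                 (γ½≤1 (complement G) {v = fzero} γk' half)

corollary3p6 : (n : ℕ) (G : Graph n) → Connected G → Connected (complement G) →
    (k k' : ℕ) → IsGammaHalf G k → IsGammaHalf (complement G) k' →
    k + k' ≤ ⌈ ⌊ n /2⌋ /2⌉ + 2
corollary3p6 zero          G _ _ _ _ γk γk' = ≤-trans (+-mono-≤ (γ½≤n G γk) (γ½≤n (complement G) γk')) z≤n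
corollary3p6 (suc zero)    G _ _ _ _ γk γk' = +-mono-≤ (γ½≤n G γk) (γ½≤n (complement G) γk')
corollary3p6 (suc (suc m)) G connected connected' _ _ γk γk' =
  ≤-trans (γ½+γ½≤⌈⌊n/2⌋/2⌉+1 G connected connected' γk γk') (+-monoʳ-≤ ⌈ ⌊ suc (suc m) /2⌋ /2⌉ (n≤1+n 1))
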